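{- Let $\mathcal{T}$ be a globular type theory satisfying the hypothesis: for every $i\in I$, if $C_i\vdash T_i$ is derivable in $\mathcal{T}$ then $\dim_C(C_i)\le\dim(T_i)$. Then type checking in $\mathcal{T}$ is decidable: for all raw contexts $\Gamma,\Delta$, raw type $A$, raw term $t$ and raw substitution $\gamma$, each of the types $\Gamma\vdash$, $\Gamma\vdash A$, $\Gamma\vdash t:A$, $\Delta\vdash\gamma:\Gamma$ is decidable (one can construct an element of $X+\neg X$ for each such judgement type $X$).
   Context: Meta-theory: Martin-Löf type theory without axiom K. The theory Glob: raw types $*$, $\Rightarrow(A,t,u)$; raw terms $\mathrm{Var}\,x$ ($x\in\mathbb{N}$); raw contexts/substitutions finite lists of pairs; judgements generated by (ec),(cc),(ob),(ar),(var),(es),(sc) below. A globular type theory is given by: a type $I$ with decidable equality; for each $i\in I$ a raw context $C_i$ of Glob derivable in Glob, and a raw type $T_i$ of the raw syntax below. Raw syntax (mutually inductive): raw types $*$, $\Rightarrow(A,t,u)$; raw terms $\mathrm{Var}\,x$ and $c_i(\gamma)$ ($i\in I$, $\gamma$ raw substitution); raw contexts finite lists of pairs $(x,A)$, raw substitutions finite lists of pairs $(x,t)$ ($\mathrm{nil}$ empty, $L::p$ appends $p$). Substitution/composition: $*[\gamma]=*$; $\Rightarrow(A,t,u)[\gamma]=\Rightarrow(A[\gamma],t[\gamma],u[\gamma])$; $\mathrm{Var}\,x[\mathrm{nil}]=\mathrm{Var}\,x$; $\mathrm{Var}\,x[\gamma::(v,t)]=t$ if $x=v$, else $\mathrm{Var}\,x[\gamma]$;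 $c_i(\gamma)[\delta]=c_i(\gamma\circ\delta)$; $\mathrm{nil}\circ\delta=\mathrm{nil}$; $(\gamma::(x,t))\circ\delta=(\gamma\circ\delta)::(x,t[\delta])$. Judgements are mutually inductive families generated by: (ec) $\mathrm{nil}\vdash$; (cc) from $\Gamma\vdash$, $\Gamma\vdash A$, $x=\mathrm{length}(\Gamma)$ derive $\Gamma::(x,A)\vdash$; (ob) from $\Gamma\vdash$ derive $\Gamma\vdash *$; (ar) from $\Gamma\vdash t:A$, $\Gamma\vdash u:A$ derive $\Gamma\vdash\Rightarrow(A,t,u)$; (var) from $\Gamma\vdash$ and $(x,A)\in\Gamma$ derive $\Gamma\vdash\mathrm{Var}\,x:A$; (tm) from $C_i\vdash T_i$ and $\Delta\vdash\gamma:C_i$ derive $\Delta\vdash c_i(\gamma):T_i[\gamma]$; (es) from $\Delta\vdash$ derive $\Delta\vdash\mathrm{nil}:\mathrm{nil}$; (sc) from $\Delta\vdash\gamma:\Gamma$, $\Gamma::(x,A)\vdash$, $\Delta\vdash t:A[\gamma]$, $x=y$ derive $\Delta\vdash\gamma::(y,t):\Gamma::(x,A)$. Dimensions: $\dim(*)=0$, $\dim(\Rightarrow(A,t,u))=\dim(A)+1$; $\dim_C(\Gamma)$ is the maximum of $\dim(A)$ over the pairs $(x,A)$ in $\Gamma$ (and $0$ for the empty context). -}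

module Defs where

open import Data.Nat using (ℕ; zero; suc; _≤_; _⊔_; _≟_)
open import Data.Product using (_×_; _,_)
open import Data.Empty using (⊥)
open import Relation.Nullary using (Dec; yes; no)
open import Relation.Binary.PropositionalEquality using (_≡_)
open import Relation.Binary.Definitions using (DecidableEquality)

module Raw (I : Set) where

  mutual
    data Ty : Set where
      ⋆ : Ty
      ⇒ : Ty → Tm → Tm → Ty

    data Tm : Set where
      Var : ℕ → Tm
      c   : I → Sub → Tm

    data Sub : Set where
      nil : Sub
      _▸_ : Sub → ℕ × Tm → Sub

  data Ctx : Set where
    nil : Ctx
    _▸_ : Ctx → ℕ × Ty → Ctx

  length : Ctx → ℕ
  length nil     = zero
  length (Γ ▸ _) = suc (length Γ)

  data _∈_ (p : ℕ × Ty) : Ctx → Set where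
    here  : ∀ {Γ} → p ∈ (Γ ▸ p)
    there : ∀ {Γ q} → p ∈ Γ → p ∈ (Γ ▸ q)

  mutual
    _[_]Ty : Ty → Sub → Ty
    ⋆ [ γ ]Ty         = ⋆
    ⇒ A t u [ γ ]Ty   = ⇒ (A [ γ ]Ty) (t [ γ ]Tm) (u [ γ ]Tm)

    _[_]Tm : Tm → Sub → Tm
    Var x [ γ ]Tm     = varSub x γ
    c i γ [ δ ]Tm     = c i (γ ∘ δ)

    varSub : ℕ → Sub → Tm
    varSub x nil = Var x
    varSub x (γ ▸ (v , t)) with x ≟ v
    ... | yes _ = t
    ... | no  _ = varSub x γ

    _∘_ : Sub → Sub → Sub
    nil ∘ δ            = nil
    (γ ▸ (x , t)) ∘ δ  = (γ ∘ δ) ▸ (x , t [ δ ]Tm)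

  dim : Ty → ℕ
  dim ⋆         = zero
  dim (⇒ A _ _) = suc (dim A)

  dimC : Ctx → ℕ
  dimC nil           = zero
  dimC (Γ ▸ (_ , A)) = dimC Γ ⊔ dim A

module Judgements (I : Set) (Cs : I → Raw.Ctx I) (Ts : I → Raw.Ty I) where
  open Raw I

  infix 4 _⊢ _⊢ty_ _⊢_∶_ _⊢s_∶_

  data _⊢ : Ctx → Set
  data _⊢ty_ : Ctx → Ty → Set
  data _⊢_∶_ : Ctx → Tm → Ty → Set
  data _⊢s_∶_ : Ctx → Sub → Ctx → Set

  data _⊢ where
    ec : nil ⊢
    cc : ∀ {Γ A x} → Γ ⊢ → Γ ⊢ty A → x ≡ length Γ → (Γ ▸ (x , A)) ⊢

  data _⊢ty_ where
    ob : ∀ {Γ} → Γ ⊢ → Γ ⊢ty ⋆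
    ar : ∀ {Γ A t u} → Γ ⊢ t ∶ A → Γ ⊢ u ∶ A → Γ ⊢ty ⇒ A t u

  data _⊢_∶_ where
    var : ∀ {Γ x A} → Γ ⊢ → (x , A) ∈ Γ → Γ ⊢ Var x ∶ A
    tm  : ∀ {Δ i γ} → Cs i ⊢ty Ts i → Δ ⊢s γ ∶ Cs i → Δ ⊢ c i γ ∶ (Ts i [ γ ]Ty)

  data _⊢s_∶_ where
    es : ∀ {Δ} → Δ ⊢ → Δ ⊢s nil ∶ nil
    sc : ∀ {Δ Γ γ x y A t} → Δ ⊢s γ ∶ Γ → (Γ ▸ (x , A)) ⊢ → Δ ⊢ t ∶ (A [ γ ]Ty) → x ≡ y
       → Δ ⊢s (γ ▸ (y , t)) ∶ (Γ ▸ (x , A))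

module Glob where
  open Raw ⊥ public
  open Judgements ⊥ (λ ()) (λ ()) public

module Embed (I : Set) where
  private module R = Raw I
  mutual
    embTy : Glob.Ty → R.Ty
    embTy Glob.⋆         = R.⋆
    embTy (Glob.⇒ A t u) = R.⇒ (embTy A) (embTm t) (embTm u)

    embTm : Glob.Tm → R.Tm
    embTm (Glob.Var x) = R.Var x
    embTm (Glob.c () _)

  embCtx : Glob.Ctx → R.Ctx
  embCtx Glob.nil           = R.nil
  embCtx (Γ Glob.▸ (x , A)) = embCtx Γ R.▸ (x , embTy A)

record GTT : Set₁ where
  field
    I     : Set
    _≟I_  : DecidableEquality I
    C     : I → Glob.Ctx
    C-wf  : (i : I) → C i Glob.⊢
    T     : I → Raw.Ty I

  open Raw I public
  open Embed I public

  Cᵀ : I → Ctx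
  Cᵀ i = embCtx (C i)

  open Judgements I Cᵀ T public

DimHyp : GTT → Set
DimHyp 𝒯 = ∀ i → Cᵀ i ⊢ty T i → Glob.dimC (C i) ≤ dim (T i)
  where open GTT 𝒯

TypeCheckingDecidable : GTT → Set
TypeCheckingDecidable 𝒯 =
    (∀ Γ → Dec (Γ ⊢))
  × (∀ Γ A → Dec (Γ ⊢ty A))
  × (∀ Γ t A → Dec (Γ ⊢ t ∶ A))
  × (∀ Δ γ Γ → Dec (Δ ⊢s γ ∶ Γ))
  where open GTT 𝒯

{-# OPTIONS --safe #-}
module Submission where

-- Checking c i γ : A needs the constructor's own typing C i ⊢ T i, of
-- dimension dim A, and the substitution γ : C i, whose types have dimension at
-- most dim T i by the hypothesis. So checking terms and substitutions of
-- dimension below n only consults constructor typings of dimension below n,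
-- and a constructor typing of dimension n is a type check of dimension n,
-- which involves only terms of dimension below n. Induction on n decides all.

open import Defs
open import Data.Nat using (ℕ; zero; suc; _≤_; _<_; _⊔_; _≟_; s≤s⁻¹)
open import Data.Nat.Properties using (≤-refl; ≤-trans; ≤-reflexive; ≤-<-trans; m⊔n<o⇒m<o; m⊔n<o⇒n<o)
open import Data.Product using (_×_; _,_; uncurry)
open import Data.Sum using (_⊎_; inj₁; inj₂)
open import Function using (_∘_)
open import Relation.Nullary using (Dec; yes; no)
open import Relation.Nullary.Decidable using (map′; _×-dec_; _⊎-dec_)
open import Relation.Binary.Definitions using (DecidableEquality)
open import Relation.Binary.PropositionalEquality using (_≡_; refl; sym; cong; cong₂; subst)

module RawProperties {I : Set} where
  open Raw I
  open Embed I

  dim-[]Ty : ∀ A γ → dim (A [ γ ]Ty) ≡ dim A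
  dim-[]Ty ⋆         γ = refl
  dim-[]Ty (⇒ A _ _) γ = cong suc (dim-[]Ty A γ)

  dim-embTy : ∀ A → dim (embTy A) ≡ Glob.dim A
  dim-embTy Glob.⋆         = refl
  dim-embTy (Glob.⇒ A _ _) = cong suc (dim-embTy A)

  dimC-embCtx : ∀ Γ → dimC (embCtx Γ) ≡ Glob.dimC Γ
  dimC-embCtx Glob.nil            = refl
  dimC-embCtx (Γ Glob.▸ (_ , A)) = cong₂ _⊔_ (dimC-embCtx Γ) (dim-embTy A)

  length-embCtx : ∀ Γ → length (embCtx Γ) ≡ Glob.length Γ
  length-embCtx Glob.nil       = refl
  length-embCtx (Γ Glob.▸ _) = cong suc (length-embCtx Γ)

  module DecidableSyntax (_≟I_ : DecidableEquality I) where

    mutual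
      _≟Ty_ : DecidableEquality Ty
      ⋆       ≟Ty ⋆         = yes refl
      ⋆       ≟Ty ⇒ _ _ _   = no λ ()
      ⇒ _ _ _ ≟Ty ⋆         = no λ ()
      ⇒ A t u ≟Ty ⇒ B s v =
        map′ (λ { (refl , refl , refl) → refl }) (λ { refl → refl , refl , refl })
             (A ≟Ty B ×-dec t ≟Tm s ×-dec u ≟Tm v)

      _≟Tm_ : DecidableEquality Tm
      Var x ≟Tm Var y = map′ (cong Var) (λ { refl → refl }) (x ≟ y)
      Var _ ≟Tm c _ _ = no λ ()
      c _ _ ≟Tm Var _ = no λ ()
      c i γ ≟Tm c j δ =
        map′ (λ { (refl , refl) → refl }) (λ { refl → refl , refl }) (i ≟I j ×-dec γ ≟Sub δ)

      _≟Sub_ : DecidableEquality Sub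
      nil           ≟Sub nil           = yes refl
      nil           ≟Sub (_ ▸ _)       = no λ ()
      (_ ▸ _)       ≟Sub nil           = no λ ()
      (γ ▸ (x , t)) ≟Sub (δ ▸ (y , s)) =
        map′ (λ { (refl , refl , refl) → refl }) (λ { refl → refl , refl , refl })
             (γ ≟Sub δ ×-dec x ≟ y ×-dec t ≟Tm s)

    _∈?_ : ∀ p Γ → Dec (p ∈ Γ)
    p ∈? nil     = no λ ()
    p ∈? (Γ ▸ q) = map′ [here,there] ∈-▸⁻ (≟-pair p q ⊎-dec p ∈? Γ)
      where
      ≟-pair : DecidableEquality (ℕ × Ty)
      ≟-pair (x , A) (y , B) =
        map′ (λ { (refl , refl) → refl }) (λ { refl → refl , refl }) (x ≟ y ×-dec A ≟Ty B)

      [here,there] : p ≡ q ⊎ p ∈ Γ → p ∈ (Γ ▸ q)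
      [here,there] (inj₁ refl) = here
      [here,there] (inj₂ p∈Γ)  = there p∈Γ

      ∈-▸⁻ : p ∈ (Γ ▸ q) → p ≡ q ⊎ p ∈ Γ
      ∈-▸⁻ here         = inj₁ refl
      ∈-▸⁻ (there p∈Γ) = inj₂ p∈Γ

module JudgementProperties (I : Set) (Cs : I → Raw.Ctx I) (Ts : I → Raw.Ty I) where
  open Raw I
  open Embed I
  open Judgements I Cs Ts
  open RawProperties

  mutual
    wf-tm : ∀ {Γ t A} → Γ ⊢ t ∶ A → Γ ⊢
    wf-tm (var w _) = w
    wf-tm (tm _ σ)  = wf-sub σ

    wf-sub : ∀ {Δ γ Γ} → Δ ⊢s γ ∶ Γ → Δ ⊢
    wf-sub (es w)         = w
    wf-sub (sc σ _ _ _) = wf-sub σ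

  wf-ty : ∀ {Γ A} → Γ ⊢ty A → Γ ⊢
  wf-ty (ob w)   = w
  wf-ty (ar a _) = wf-tm a

  wf-cod : ∀ {Δ γ Γ} → Δ ⊢s γ ∶ Γ → Γ ⊢
  wf-cod (es _)         = ec
  wf-cod (sc _ w _ _) = w

  cc⁻ : ∀ {Γ x A} → (Γ ▸ (x , A)) ⊢ → Γ ⊢ × Γ ⊢ty A × x ≡ length Γ
  cc⁻ (cc w a e) = w , a , e

  ar⁻ : ∀ {Γ A t u} → Γ ⊢ty ⇒ A t u → Γ ⊢ t ∶ A × Γ ⊢ u ∶ A
  ar⁻ (ar a b) = a , b

  var⁻ : ∀ {Γ x A} → Γ ⊢ Var x ∶ A → (x , A) ∈ Γ
  var⁻ (var _ m) = m

  tm⁻ : ∀ {Δ i γ A} → Δ ⊢ c i γ ∶ A → A ≡ Ts i [ γ ]Ty × Cs i ⊢ty Ts i × Δ ⊢s γ ∶ Cs i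
  tm⁻ (tm a σ) = refl , a , σ

  sc⁻ : ∀ {Δ γ y t Γ x A} → Δ ⊢s (γ ▸ (y , t)) ∶ (Γ ▸ (x , A))
      → Δ ⊢s γ ∶ Γ × Δ ⊢ t ∶ (A [ γ ]Ty) × x ≡ y
  sc⁻ (sc σ _ a e) = σ , a , e

  embed-∈ : ∀ {x A Γ} → (x , A) Glob.∈ Γ → (x , embTy A) ∈ embCtx Γ
  embed-∈ Glob.here      = here
  embed-∈ (Glob.there m) = there (embed-∈ m)

  mutual
    embed-ctx : ∀ {Γ} → Γ Glob.⊢ → embCtx Γ ⊢
    embed-ctx Glob.ec = ec
    embed-ctx {Γ Glob.▸ _} (Glob.cc w a e) =
      cc (embed-ctx w) (embed-ty a) (subst (_ ≡_) (sym (length-embCtx Γ)) e)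

    embed-ty : ∀ {Γ A} → Γ Glob.⊢ty A → embCtx Γ ⊢ty embTy A
    embed-ty (Glob.ob w)   = ob (embed-ctx w)
    embed-ty (Glob.ar a b) = ar (embed-tm a) (embed-tm b)

    embed-tm : ∀ {Γ t A} → Γ Glob.⊢ t ∶ A → embCtx Γ ⊢ embTm t ∶ embTy A
    embed-tm (Glob.var w m) = var (embed-ctx w) (embed-∈ m)
    embed-tm (Glob.tm {i = ()} _ _)

module TypeChecker (𝒯 : GTT) (hyp : DimHyp 𝒯) where
  open GTT 𝒯 hiding (_∘_)
  open RawProperties
  open DecidableSyntax _≟I_
  open JudgementProperties I Cᵀ T

  Cᵀ-wf : ∀ i → Cᵀ i ⊢
  Cᵀ-wf i = embed-ctx (C-wf i)

  ConstructorsDecidedBelow : ℕ → Set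
  ConstructorsDecidedBelow n = ∀ i → dim (T i) < n → Dec (Cᵀ i ⊢ty T i)

  mutual
    checkTm : ∀ n → ConstructorsDecidedBelow n → ∀ {Δ} → Δ ⊢ → ∀ t A → dim A < n
            → Dec (Δ ⊢ t ∶ A)
    checkTm n decided {Δ} w (Var x) A _ = map′ (var w) var⁻ ((x , A) ∈? Δ)
    checkTm n decided w (c i γ) A dimA<n with A ≟Ty (T i [ γ ]Ty)
    ... | no A≢ = no (A≢ ∘ λ d → let e , _ = tm⁻ d in e)
    ... | yes refl with decided i dimT<n
      where
      dimT<n : dim (T i) < n
      dimT<n = subst (_< n) (dim-[]Ty (T i) γ) dimA<n
    ... | no ¬Ti = no (¬Ti ∘ λ d → let _ , Ti , _ = tm⁻ d in Ti)
    ... | yes Ti = map′ (tm Ti) (λ d → let _ , _ , σ = tm⁻ d in σ)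
                        (checkSub n decided w γ (Cᵀ-wf i) dimC<n)
      where
      dimC<n : dimC (Cᵀ i) < n
      dimC<n = ≤-<-trans (≤-trans (≤-reflexive (dimC-embCtx (C i))) (hyp i Ti))
                         (subst (_< n) (dim-[]Ty (T i) γ) dimA<n)

    checkSub : ∀ n → ConstructorsDecidedBelow n → ∀ {Δ} → Δ ⊢ → ∀ γ {Γ} → Γ ⊢ → dimC Γ < n
             → Dec (Δ ⊢s γ ∶ Γ)
    checkSub n decided w nil {nil}   _ _ = yes (es w)
    checkSub n decided w nil {_ ▸ _} _ _ = no λ ()
    checkSub n decided w (_ ▸ _) {nil} _ _ = no λ ()
    checkSub n decided w (γ ▸ (y , t)) {Γ ▸ (x , A)} Γ▸A dim<n =
      map′ (λ (σ , a , e) → sc σ Γ▸A a e) sc⁻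
           (checkSub n decided w γ Γ-wf (m⊔n<o⇒m<o _ _ dim<n)
            ×-dec checkTm n decided w t (A [ γ ]Ty) dimA[γ]<n
            ×-dec x ≟ y)
      where
      Γ-wf : Γ ⊢
      Γ-wf = let w′ , _ = cc⁻ Γ▸A in w′
      dimA[γ]<n : dim (A [ γ ]Ty) < n
      dimA[γ]<n = subst (_< n) (sym (dim-[]Ty A γ)) (m⊔n<o⇒n<o (dimC Γ) _ dim<n)

  checkTy : ∀ n → ConstructorsDecidedBelow n → ∀ {Γ} → Γ ⊢ → ∀ A → dim A ≤ n → Dec (Γ ⊢ty A)
  checkTy n decided w ⋆         _        = yes (ob w)
  checkTy n decided w (⇒ A t u) dimA<n =
    map′ (uncurry ar) ar⁻ (checkTm n decided w t A dimA<n ×-dec checkTm n decided w u A dimA<n)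

  constructorsDecided : ∀ n → ConstructorsDecidedBelow n
  constructorsDecided zero    i ()
  constructorsDecided (suc n) i dimT<1+n =
    checkTy n (constructorsDecided n) (Cᵀ-wf i) (T i) (s≤s⁻¹ dimT<1+n)

  ty-under : ∀ {Γ} → Γ ⊢ → ∀ A → Dec (Γ ⊢ty A)
  ty-under w A = checkTy (dim A) (constructorsDecided _) w A ≤-refl

  ctx? : ∀ Γ → Dec (Γ ⊢)
  ctx? nil           = yes ec
  ctx? (Γ ▸ (x , A)) with ctx? Γ
  ... | no ¬w = no (¬w ∘ λ d → let w , _ = cc⁻ d in w)
  ... | yes w = map′ (λ (a , e) → cc w a e) (λ d → let _ , a , e = cc⁻ d in a , e)
                     (ty-under w A ×-dec x ≟ length Γ)

  ty? : ∀ Γ A → Dec (Γ ⊢ty A)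
  ty? Γ A with ctx? Γ
  ... | no ¬w = no (¬w ∘ wf-ty)
  ... | yes w = ty-under w A

  tm? : ∀ Γ t A → Dec (Γ ⊢ t ∶ A)
  tm? Γ t A with ctx? Γ
  ... | no ¬w = no (¬w ∘ wf-tm)
  ... | yes w = checkTm (suc (dim A)) (constructorsDecided _) w t A ≤-refl

  sub? : ∀ Δ γ Γ → Dec (Δ ⊢s γ ∶ Γ)
  sub? Δ γ Γ with ctx? Δ | ctx? Γ
  ... | no ¬w | _     = no (¬w ∘ wf-sub)
  ... | yes _ | no ¬v = no (¬v ∘ wf-cod)
  ... | yes w | yes v = checkSub (suc (dimC Γ)) (constructorsDecided _) w γ v ≤-refl

mainTheorem13 : (𝒯 : GTT) → DimHyp 𝒯 → TypeCheckingDecidable 𝒯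
mainTheorem13 𝒯 hyp = ctx? , ty? , tm? , sub?
  where open TypeChecker 𝒯 hyp
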